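{- Let $K\subseteq\mathbb{R}$ be any subset satisfying $-K=K$. If $n\in\{2,4,8\}$, then $E_K(n,1)=n$.
   Context: A system $v_1,\ldots,v_k$ of vectors in $\mathbb{R}^n$ is called orthoregular if (i) $v_i\perp v_j$ (standard inner product) for $i\neq j$, and (ii) $|v_i|=|v_j|\neq 0$ for all $i,j$ ($|\cdot|$ the Euclidean norm); the common value is the length of the system. For an orthoregular system $S\subset\mathbb{Z}^n$, $E(S)$ denotes the maximum number of vectors in an orthoregular system of integer vectors in $\mathbb{Z}^n$ containing $S$. For integers $0<k<n$ and $K\subseteq\mathbb{R}$, $E_K(n,k)$ denotes the minimum of $E(S)$ over all orthoregular systems $S\subset\mathbb{Z}^n$ with $k$ elements whose length lies in $K$. -}

module Defs where

open import Data.Nat using (ℕ; zero; suc; _≤_)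
open import Data.Integer using (ℤ; +_; _+_; _*_; ∣_∣)
open import Data.Fin using (Fin)
open import Data.Vec using (Vec; []; _∷_)
open import Data.Product using (Σ; ∃; _×_)
open import Relation.Binary.PropositionalEquality using (_≡_; _≢_)

ZVec : ℕ → Set
ZVec n = Vec ℤ n

dot : ∀ {n} → ZVec n → ZVec n → ℤ
dot [] [] = + 0
dot (x ∷ xs) (y ∷ ys) = x * y + dot xs ys

sqNorm : ∀ {n} → ZVec n → ℕ
sqNorm v = ∣ dot v v ∣

System : ℕ → ℕ → Set
System n k = Fin k → ZVec n

Orthoregular : ∀ {n k} → System n k → Set
Orthoregular {n} {k} S =
  (∀ (i j : Fin k) → i ≢ j → dot (S i) (S j) ≡ + 0) ×
  (∀ (i j : Fin k) → sqNorm (S i) ≡ sqNorm (S j)) ×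
  (∀ (i : Fin k) → sqNorm (S i) ≢ 0)

_⊆ₛ_ : ∀ {n k m} → System n k → System n m → Set
_⊆ₛ_ {k = k} {m = m} S T = ∀ (i : Fin k) → ∃ λ (j : Fin m) → S i ≡ T j

HasE : ∀ {n k} → System n k → ℕ → Set
HasE {n} S e =
  (Σ (System n e) λ T → Orthoregular T × S ⊆ₛ T) ×
  (∀ (m : ℕ) (T : System n m) → Orthoregular T → S ⊆ₛ T → m ≤ e)

-- The length set K ⊆ ℝ is represented by the predicate InK on squared lengths:
-- InK m  means  √m ∈ K.
-- S is admissible for E_K(n,k): orthoregular with k elements, its length in K.
Admissible : ∀ {n k} → (ℕ → Set) → System n k → Set
Admissible {k = k} InK S = Orthoregular S × (∀ (i : Fin k) → InK (sqNorm (S i)))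

HasEK : (ℕ → Set) → (n k : ℕ) → ℕ → Set
HasEK InK n k e =
  (Σ (System n k) λ S → Admissible InK S × HasE S e) ×
  (∀ (S : System n k) → Admissible InK S → ∀ (f : ℕ) → HasE S f → e ≤ f)

module Submission where

open import Defs
open import Data.Nat using (ℕ)
open import Data.Product using (Σ)
open import Data.Sum using (_⊎_)
open import Relation.Binary.PropositionalEquality using (_≡_)

import Data.Integer as ℤ
import Data.Integer.Properties as ℤP
import Data.Nat.Properties as ℕP
open import Algebra.Properties.Semiring.Sum ℤP.+-*-semiring
open import Data.Fin using (Fin; zero; suc; punchIn)
open import Data.Fin.Patterns using (0F; 1F; 2F; 3F; 4F; 5F; 6F; 7F)
open import Data.Fin.Permutation using (permutation)
open import Data.Fin.Properties using (all?; punchInᵢ≢i)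
open import Data.Integer
  using (ℤ; +_; +0; +[1+_]; -[1+_]; 0ℤ; 1ℤ; -1ℤ; -_; _+_; _*_; _≤_; _<_; ∣_∣; +≤+; +<+)
open import Data.Integer.Tactic.RingSolver using (solve-∀)
open import Data.Nat as ℕ using (zero; suc; z≤n)
open import Data.Product using (_,_; _×_; proj₁; proj₂)
open import Data.Sum using (inj₁; inj₂)
open import Data.Vec using (Vec; []; _∷_; lookup; tabulate)
open import Data.Vec.Properties using (lookup∘tabulate; tabulate∘lookup; tabulate-cong)
open import Function using (_∘_)
open import Relation.Binary.PropositionalEquality
  using (_≢_; refl; sym; trans; cong; cong₂; subst; module ≡-Reasoning)
open import Relation.Nullary using (Dec; ¬?)
open import Relation.Nullary.Decidable using (_×-dec_; _→-dec_; from-yes; map′)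

import Data.Fin as Fin

-- For n = 2, 4, 8 the matrix of left multiplication by a complex number, quaternion or
-- octonion a is an orthogonal design: its rows are signed permutations of the coordinates
-- of a, pairwise orthogonal and all of length |a|.  So every nonzero v ∈ ℤⁿ lies in an
-- orthoregular system of n integer vectors.  Conversely, Bessel's inequality against each
-- coordinate vector bounds the size of any orthoregular system in ℤⁿ by n.  Hence E(S) = n
-- for every single vector S, and the minimum E_K(n,1) is n.

i≡-i⇒i≡0 : ∀ {i} → i ≡ - i → i ≡ 0ℤ
i≡-i⇒i≡0 {+0}        _  = refl
i≡-i⇒i≡0 {+[1+ _ ]}  ()
i≡-i⇒i≡0 { -[1+ _ ]} ()

0≤i*i : ∀ i → 0ℤ ≤ i * i
0≤i*i +0       = +≤+ z≤n
0≤i*i +[1+ _ ] = +≤+ z≤n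
0≤i*i -[1+ _ ] = +≤+ z≤n

i*i≤i*j⇒i≤j : ∀ {i j} → 0ℤ ≤ i → 0ℤ ≤ j → i * i ≤ i * j → i ≤ j
i*i≤i*j⇒i≤j {+0}           _ 0≤j _     = 0≤j
i*i≤i*j⇒i≤j {+[1+ n ]} {j} _ _   ii≤ij = ℤP.*-cancelˡ-≤-pos +[1+ n ] j +[1+ n ] ii≤ij

∑-zero : ∀ {n} {f : Fin n → ℤ} → (∀ i → f i ≡ 0ℤ) → sum f ≡ 0ℤ
∑-zero {n} f≡0 = trans (sum-cong-≗ f≡0) (sum-replicate-zero n)

∑-single : ∀ {n} {f : Fin n → ℤ} k → (∀ i → i ≢ k → f i ≡ 0ℤ) → sum f ≡ f k
∑-single {suc n} {f} k others = begin
  sum f                         ≡⟨ sum-remove {i = k} f ⟩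
  f k + sum (f ∘ punchIn k)     ≡⟨ cong (_+_ (f k)) (∑-zero (λ i → others (punchIn k i) (punchInᵢ≢i k i))) ⟩
  f k + 0ℤ                      ≡⟨ ℤP.+-identityʳ (f k) ⟩
  f k                           ∎
  where open ≡-Reasoning

∑-const : ∀ m x → ∑[ i < m ] x ≡ + m * x
∑-const zero    x = sym (ℤP.*-zeroˡ x)
∑-const (suc m) x = trans (cong (_+_ x) (∑-const m x)) (sym (ℤP.suc-* (+ m) x))

∑-neg : ∀ {n} (f : Fin n → ℤ) → ∑[ k < n ] (- f k) ≡ - sum f
∑-neg f = begin
  ∑[ k < _ ] (- f k)      ≡⟨ sum-cong-≗ (λ k → sym (ℤP.-1*i≡-i (f k))) ⟩
  ∑[ k < _ ] (-1ℤ * f k)  ≡⟨ sym (*-distribˡ-sum -1ℤ f) ⟩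
  -1ℤ * sum f             ≡⟨ ℤP.-1*i≡-i (sum f) ⟩
  - sum f                 ∎
  where open ≡-Reasoning

∑-mono-≤ : ∀ {n} {f g : Fin n → ℤ} → (∀ i → f i ≤ g i) → sum f ≤ sum g
∑-mono-≤ {zero}  f≤g = ℤP.≤-refl
∑-mono-≤ {suc n} f≤g = ℤP.+-mono-≤ (f≤g zero) (∑-mono-≤ (f≤g ∘ suc))

∑-nonNeg : ∀ {n} {f : Fin n → ℤ} → (∀ i → 0ℤ ≤ f i) → 0ℤ ≤ sum f
∑-nonNeg {n} {f} 0≤f = subst (_≤ sum f) (sum-replicate-zero n) (∑-mono-≤ 0≤f)

term≤∑ : ∀ {n} {f : Fin n → ℤ} → (∀ i → 0ℤ ≤ f i) → ∀ k → f k ≤ sum f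
term≤∑ {suc n} {f} 0≤f k = begin
  f k                        ≡⟨ ℤP.+-identityʳ (f k) ⟨
  f k + 0ℤ                   ≤⟨ ℤP.+-monoʳ-≤ (f k) (∑-nonNeg (0≤f ∘ punchIn k)) ⟩
  f k + sum (f ∘ punchIn k)  ≡⟨ sum-remove {i = k} f ⟨
  sum f                      ∎
  where open ℤP.≤-Reasoning

∑-reindex : ∀ {n} (f : Fin n → ℤ) (τ : Fin n → Fin n) → (∀ k → τ (τ k) ≡ k) →
            sum (f ∘ τ) ≡ sum f
∑-reindex f τ τ-involutive = sym (∑-permute f (permutation τ τ τ-involutive τ-involutive))

∑-antisymmetric : ∀ {n} (f : Fin n → ℤ) (τ : Fin n → Fin n) → (∀ k → τ (τ k) ≡ k) →
                  (∀ k → f (τ k) ≡ - f k) → sum f ≡ 0ℤ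
∑-antisymmetric f τ τ-involutive f∘τ≡-f = i≡-i⇒i≡0 (begin
  sum f               ≡⟨ ∑-reindex f τ τ-involutive ⟨
  sum (f ∘ τ)         ≡⟨ sum-cong-≗ f∘τ≡-f ⟩
  ∑[ k < _ ] (- f k)  ≡⟨ ∑-neg f ⟩
  - sum f             ∎)
  where open ≡-Reasoning

dot≡∑ : ∀ {n} (u w : ZVec n) → dot u w ≡ ∑[ l < n ] (lookup u l * lookup w l)
dot≡∑ []      []      = refl
dot≡∑ (x ∷ u) (y ∷ w) = cong (_+_ (x * y)) (dot≡∑ u w)

+sqNorm≡dot : ∀ {n} (u : ZVec n) → + sqNorm u ≡ dot u u
+sqNorm≡dot u = ℤP.0≤i⇒+∣i∣≡i (subst (0ℤ ≤_) (sym (dot≡∑ u u)) (∑-nonNeg (0≤i*i ∘ lookup u)))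

module OrthogonalFamily {m n : ℕ} (v : Fin m → Fin n → ℤ) (L : ℤ)
  (orthogonal : ∀ i j → i ≢ j → ∑[ l < n ] (v i l * v j l) ≡ 0ℤ)
  (normalised : ∀ i → ∑[ l < n ] (v i l * v i l) ≡ L) where

  combination : (Fin m → ℤ) → Fin n → ℤ
  combination c l = ∑[ i < m ] (c i * v i l)

  combination-coefficient : ∀ c j → ∑[ l < n ] (combination c l * v j l) ≡ c j * L
  combination-coefficient c j = begin
    ∑[ l < n ] (combination c l * v j l)
      ≡⟨ sum-cong-≗ (λ l → *-distribʳ-sum (v j l) (λ i → c i * v i l)) ⟩
    ∑[ l < n ] ∑[ i < m ] (c i * v i l * v j l)
      ≡⟨ ∑-comm (λ l i → c i * v i l * v j l) ⟩
    ∑[ i < m ] ∑[ l < n ] (c i * v i l * v j l)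
      ≡⟨ sum-cong-≗ (λ i → trans (sum-cong-≗ (λ l → ℤP.*-assoc (c i) (v i l) (v j l)))
                                 (sym (*-distribˡ-sum (c i) (λ l → v i l * v j l)))) ⟩
    ∑[ i < m ] (c i * ∑[ l < n ] (v i l * v j l))
      ≡⟨ ∑-single j (λ i i≢j → trans (cong (c i *_) (orthogonal i j i≢j)) (ℤP.*-zeroʳ (c i))) ⟩
    c j * ∑[ l < n ] (v j l * v j l)
      ≡⟨ cong (c j *_) (normalised j) ⟩
    c j * L ∎
    where open ≡-Reasoning

  combination-sqNorm : ∀ c → ∑[ l < n ] (combination c l * combination c l) ≡ (∑[ i < m ] (c i * c i)) * L
  combination-sqNorm c = begin
    ∑[ l < n ] (s l * s l)
      ≡⟨ sum-cong-≗ (λ l → *-distribˡ-sum (s l) (λ i → c i * v i l)) ⟩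
    ∑[ l < n ] ∑[ i < m ] (s l * (c i * v i l))
      ≡⟨ ∑-comm (λ l i → s l * (c i * v i l)) ⟩
    ∑[ i < m ] ∑[ l < n ] (s l * (c i * v i l))
      ≡⟨ sum-cong-≗ (λ i → trans (sum-cong-≗ (λ l → exchange (s l) (c i) (v i l)))
                                 (sym (*-distribˡ-sum (c i) (λ l → s l * v i l)))) ⟩
    ∑[ i < m ] (c i * ∑[ l < n ] (s l * v i l))
      ≡⟨ sum-cong-≗ (λ i → trans (cong (c i *_) (combination-coefficient c i))
                                 (sym (ℤP.*-assoc (c i) (c i) L))) ⟩
    ∑[ i < m ] (c i * c i * L)
      ≡⟨ *-distribʳ-sum L (λ i → c i * c i) ⟨
    (∑[ i < m ] (c i * c i)) * L ∎
    where
    open ≡-Reasoning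
    s : Fin n → ℤ
    s = combination c
    exchange : ∀ a b d → a * (b * d) ≡ b * (a * d)
    exchange = solve-∀

  -- Bessel's inequality for the coordinate vector e_k: the combination with coefficients
  -- c i = v i k has k-th coordinate Q and squared length Q L, so Q² ≤ Q L.
  column-bound : 0ℤ ≤ L → ∀ k → ∑[ i < m ] (v i k * v i k) ≤ L
  column-bound 0≤L k = i*i≤i*j⇒i≤j (∑-nonNeg (0≤i*i ∘ c)) 0≤L (begin
    Q * Q                                           ≤⟨ term≤∑ (λ l → 0≤i*i (combination c l)) k ⟩
    ∑[ l < n ] (combination c l * combination c l)  ≡⟨ combination-sqNorm c ⟩
    Q * L                                           ∎)
    where
    open ℤP.≤-Reasoning
    c : Fin m → ℤ
    c i = v i k
    Q : ℤ
    Q = ∑[ i < m ] (c i * c i)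

  size≤dimension : 0ℤ < L → m ℕ.≤ n
  size≤dimension 0<L = ℤP.drop‿+≤+ (ℤP.*-cancelʳ-≤-pos (+ m) (+ n) L {{ℤ.positive 0<L}} (begin
    + m * L                                 ≡⟨ ∑-const m L ⟨
    ∑[ i < m ] L                            ≡⟨ sum-cong-≗ (sym ∘ normalised) ⟩
    ∑[ i < m ] ∑[ l < n ] (v i l * v i l)   ≡⟨ ∑-comm (λ i l → v i l * v i l) ⟩
    ∑[ l < n ] ∑[ i < m ] (v i l * v i l)   ≤⟨ ∑-mono-≤ (column-bound (ℤP.<⇒≤ 0<L)) ⟩
    ∑[ l < n ] L                            ≡⟨ ∑-const n L ⟩
    + n * L                                 ∎))
    where open ℤP.≤-Reasoning

orthoregular-size≤dimension : ∀ {n m} (T : System n m) → Orthoregular T → m ℕ.≤ n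
orthoregular-size≤dimension {m = zero}  T _ = z≤n
orthoregular-size≤dimension {m = suc _} T (orthogonal , equal-length , nonzero) =
  OrthogonalFamily.size≤dimension (lookup ∘ T) (+ sqNorm (T zero))
    (λ i j i≢j → trans (sym (dot≡∑ (T i) (T j))) (orthogonal i j i≢j))
    (λ i → trans (sym (dot≡∑ (T i) (T i)))
                 (trans (sym (+sqNorm≡dot (T i))) (cong +_ (equal-length i zero))))
    (+<+ (ℕP.n≢0⇒n>0 (nonzero zero)))

data SignedIndex (n : ℕ) : Set where
  +x_ -x_ : Fin n → SignedIndex n

indexOf : ∀ {n} → SignedIndex n → Fin n
indexOf (+x p) = p
indexOf (-x p) = p

signOf : ∀ {n} → SignedIndex n → ℤ
signOf (+x _) = 1ℤ
signOf (-x _) = -1ℤ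

signOf-square : ∀ {n} (e : SignedIndex n) → signOf e * signOf e ≡ 1ℤ
signOf-square (+x _) = refl
signOf-square (-x _) = refl

Design : ℕ → Set
Design n = Vec (Vec (SignedIndex n) n) n

module _ {n} (D : Design n) where

  index : Fin n → Fin n → Fin n
  index i k = indexOf (lookup (lookup D i) k)

  sign : Fin n → Fin n → ℤ
  sign i k = signOf (lookup (lookup D i) k)

  row : (Fin n → ℤ) → Fin n → Fin n → ℤ
  row a i k = sign i k * a (index i k)

  -- partner i j k is the position in row i of the variable at position k of row j.
  partner : Fin n → Fin n → Fin n → Fin n
  partner i j k = index i (index j k)

record IsOrthogonalDesign {n} (D : Design (suc n)) : Set where
  field
    index-first-row  : ∀ k → index D zero k ≡ k
    sign-first-row   : ∀ k → sign D zero k ≡ 1ℤ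
    index-involutive : ∀ i k → index D i (index D i k) ≡ k
    partner-index    : ∀ i j → i ≢ j → ∀ k → index D j (partner D i j k) ≡ index D i k
    partner-sign     : ∀ i j → i ≢ j → ∀ k →
                       sign D i (partner D i j k) * sign D j (partner D i j k) ≡ - (sign D i k * sign D j k)

isOrthogonalDesign? : ∀ {n} (D : Design (suc n)) → Dec (IsOrthogonalDesign D)
isOrthogonalDesign? D = map′
  (λ (p₁ , p₂ , p₃ , p₄ , p₅) → record
    { index-first-row = p₁ ; sign-first-row = p₂ ; index-involutive = p₃
    ; partner-index = p₄ ; partner-sign = p₅ })
  (λ isOD → let open IsOrthogonalDesign isOD in
    index-first-row , sign-first-row , index-involutive , partner-index , partner-sign)
  ( (all? λ k → index D zero k Fin.≟ k)
  ×-dec (all? λ k → sign D zero k ℤ.≟ 1ℤ)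
  ×-dec (all? λ i → all? λ k → index D i (index D i k) Fin.≟ k)
  ×-dec (all? λ i → all? λ j → ¬? (i Fin.≟ j) →-dec all? λ k →
           index D j (partner D i j k) Fin.≟ index D i k)
  ×-dec (all? λ i → all? λ j → ¬? (i Fin.≟ j) →-dec all? λ k →
           sign D i (partner D i j k) * sign D j (partner D i j k) ℤ.≟ - (sign D i k * sign D j k)))

module OrthogonalDesign {n} {D : Design (suc n)} (isOD : IsOrthogonalDesign D) (a : Fin (suc n) → ℤ) where
  open IsOrthogonalDesign isOD

  row-first : ∀ k → row D a zero k ≡ a k
  row-first k = begin
    sign D zero k * a (index D zero k) ≡⟨ cong₂ (λ s p → s * a p) (sign-first-row k) (index-first-row k) ⟩
    1ℤ * a k                           ≡⟨ ℤP.*-identityˡ (a k) ⟩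
    a k                                ∎
    where open ≡-Reasoning

  row-sqNorm : ∀ i → ∑[ k < suc n ] (row D a i k * row D a i k) ≡ ∑[ k < suc n ] (a k * a k)
  row-sqNorm i = begin
    ∑[ k < suc n ] (row D a i k * row D a i k)
      ≡⟨ sum-cong-≗ drop-sign ⟩
    ∑[ k < suc n ] (a (index D i k) * a (index D i k))
      ≡⟨ ∑-reindex (λ p → a p * a p) (index D i) (index-involutive i) ⟩
    ∑[ k < suc n ] (a k * a k) ∎
    where
    open ≡-Reasoning
    square-sign : ∀ s x → s * s ≡ 1ℤ → s * x * (s * x) ≡ x * x
    square-sign s x s²≡1 = trans (lemma s x) (trans (cong (_* (x * x)) s²≡1) (ℤP.*-identityˡ (x * x)))
      where lemma : ∀ s x → s * x * (s * x) ≡ s * s * (x * x)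
            lemma = solve-∀
    drop-sign : ∀ k → row D a i k * row D a i k ≡ a (index D i k) * a (index D i k)
    drop-sign k = square-sign (sign D i k) (a (index D i k)) (signOf-square (lookup (lookup D i) k))

  -- The involution τ = partner i j swaps the variables read off rows i and j and flips
  -- the product of their signs, so the terms of the dot product cancel in pairs.
  row-orthogonal : ∀ i j → i ≢ j → ∑[ k < suc n ] (row D a i k * row D a j k) ≡ 0ℤ
  row-orthogonal i j i≢j = ∑-antisymmetric f τ τ-involutive f∘τ≡-f
    where
    open ≡-Reasoning
    f : Fin (suc n) → ℤ
    f k = row D a i k * row D a j k
    τ : Fin (suc n) → Fin (suc n)
    τ = partner D i j
    τ-involutive : ∀ k → τ (τ k) ≡ k
    τ-involutive k = trans (cong (index D i) (partner-index i j i≢j k)) (index-involutive i k)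
    sign-swap : ∀ s t s′ t′ x y → s′ * t′ ≡ - (s * t) → s′ * y * (t′ * x) ≡ - (s * x * (t * y))
    sign-swap s t s′ t′ x y eq = begin
      s′ * y * (t′ * x)   ≡⟨ regroup s′ t′ x y ⟩
      s′ * t′ * (x * y)   ≡⟨ cong (_* (x * y)) eq ⟩
      - (s * t) * (x * y) ≡⟨ regroup-neg s t x y ⟩
      - (s * x * (t * y)) ∎
      where
      regroup : ∀ s t x y → s * y * (t * x) ≡ s * t * (x * y)
      regroup = solve-∀
      regroup-neg : ∀ s t x y → - (s * t) * (x * y) ≡ - (s * x * (t * y))
      regroup-neg = solve-∀
    f∘τ≡-f : ∀ k → f (τ k) ≡ - f k
    f∘τ≡-f k = begin
      f (τ k)
        ≡⟨ cong₂ (λ p q → sign D i (τ k) * a p * (sign D j (τ k) * a q))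
                 (index-involutive i (index D j k)) (partner-index i j i≢j k) ⟩
      sign D i (τ k) * a (index D j k) * (sign D j (τ k) * a (index D i k))
        ≡⟨ sign-swap (sign D i k) (sign D j k) (sign D i (τ k)) (sign D j (τ k))
                     (a (index D i k)) (a (index D j k)) (partner-sign i j i≢j k) ⟩
      - f k ∎

designSystem : ∀ {n} → Design n → ZVec n → System n n
designSystem D v i = tabulate (row D (lookup v) i)

dot-designSystem : ∀ {n} (D : Design n) (v : ZVec n) i j →
  dot (designSystem D v i) (designSystem D v j) ≡
  ∑[ k < n ] (row D (lookup v) i k * row D (lookup v) j k)
dot-designSystem D v i j = trans (dot≡∑ (designSystem D v i) (designSystem D v j))
  (sum-cong-≗ (λ k → cong₂ _*_ (lookup∘tabulate (row D (lookup v) i) k)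
                               (lookup∘tabulate (row D (lookup v) j) k)))

OrthoregularExtension : ∀ {n k} → System n k → ℕ → Set
OrthoregularExtension {n} S e = Σ (System n e) λ T → Orthoregular T × S ⊆ₛ T

designSystem-extension : ∀ {n} {D : Design (suc n)} → IsOrthogonalDesign D →
  (S : System (suc n) 1) → Orthoregular S → OrthoregularExtension S (suc n)
designSystem-extension {n} {D} isOD S (_ , _ , nonzero) =
  T , (orthogonal , equal-length , nonzero-T) , λ { zero → zero , sym first-row }
  where
  a : Fin (suc n) → ℤ
  a = lookup (S zero)
  open OrthogonalDesign isOD a
  T : System (suc n) (suc n)
  T = designSystem D (S zero)
  orthogonal : ∀ i j → i ≢ j → dot (T i) (T j) ≡ 0ℤ
  orthogonal i j i≢j = trans (dot-designSystem D (S zero) i j) (row-orthogonal i j i≢j)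
  sqNorm-T : ∀ i → sqNorm (T i) ≡ sqNorm (S zero)
  sqNorm-T i = cong ∣_∣ (begin
    dot (T i) (T i)                                       ≡⟨ dot-designSystem D (S zero) i i ⟩
    ∑[ k < _ ] (row D a i k * row D a i k)                ≡⟨ row-sqNorm i ⟩
    ∑[ k < _ ] (a k * a k)                                ≡⟨ dot≡∑ (S zero) (S zero) ⟨
    dot (S zero) (S zero)                                 ∎)
    where open ≡-Reasoning
  equal-length : ∀ i j → sqNorm (T i) ≡ sqNorm (T j)
  equal-length i j = trans (sqNorm-T i) (sym (sqNorm-T j))
  nonzero-T : ∀ i → sqNorm (T i) ≢ 0
  nonzero-T i = nonzero zero ∘ trans (sym (sqNorm-T i))
  first-row : T zero ≡ S zero
  first-row = trans (tabulate-cong row-first) (tabulate∘lookup (S zero))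

complexDesign : Design 2
complexDesign =
  (+x 0F ∷ +x 1F ∷ []) ∷
  (-x 1F ∷ +x 0F ∷ []) ∷ []

quaternionDesign : Design 4
quaternionDesign =
  (+x 0F ∷ +x 1F ∷ +x 2F ∷ +x 3F ∷ []) ∷
  (-x 1F ∷ +x 0F ∷ +x 3F ∷ -x 2F ∷ []) ∷
  (-x 2F ∷ -x 3F ∷ +x 0F ∷ +x 1F ∷ []) ∷
  (-x 3F ∷ +x 2F ∷ -x 1F ∷ +x 0F ∷ []) ∷ []

octonionDesign : Design 8
octonionDesign =
  (+x 0F ∷ +x 1F ∷ +x 2F ∷ +x 3F ∷ +x 4F ∷ +x 5F ∷ +x 6F ∷ +x 7F ∷ []) ∷
  (-x 1F ∷ +x 0F ∷ +x 3F ∷ -x 2F ∷ +x 5F ∷ -x 4F ∷ -x 7F ∷ +x 6F ∷ []) ∷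
  (-x 2F ∷ -x 3F ∷ +x 0F ∷ +x 1F ∷ +x 6F ∷ +x 7F ∷ -x 4F ∷ -x 5F ∷ []) ∷
  (-x 3F ∷ +x 2F ∷ -x 1F ∷ +x 0F ∷ +x 7F ∷ -x 6F ∷ +x 5F ∷ -x 4F ∷ []) ∷
  (-x 4F ∷ -x 5F ∷ -x 6F ∷ -x 7F ∷ +x 0F ∷ +x 1F ∷ +x 2F ∷ +x 3F ∷ []) ∷
  (-x 5F ∷ +x 4F ∷ -x 7F ∷ +x 6F ∷ -x 1F ∷ +x 0F ∷ -x 3F ∷ +x 2F ∷ []) ∷
  (-x 6F ∷ +x 7F ∷ +x 4F ∷ -x 5F ∷ -x 2F ∷ +x 3F ∷ +x 0F ∷ -x 1F ∷ []) ∷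
  (-x 7F ∷ -x 6F ∷ +x 5F ∷ +x 4F ∷ -x 3F ∷ -x 2F ∷ +x 1F ∷ +x 0F ∷ []) ∷ []

singleton-extension : ∀ {n} → n ≡ 2 ⊎ n ≡ 4 ⊎ n ≡ 8 →
  (S : System n 1) → Orthoregular S → OrthoregularExtension S n
singleton-extension (inj₁ refl)        = designSystem-extension (from-yes (isOrthogonalDesign? complexDesign))
singleton-extension (inj₂ (inj₁ refl)) = designSystem-extension (from-yes (isOrthogonalDesign? quaternionDesign))
singleton-extension (inj₂ (inj₂ refl)) = designSystem-extension (from-yes (isOrthogonalDesign? octonionDesign))

E≡dimension : ∀ {n k} (S : System n k) → OrthoregularExtension S n → HasE S n
E≡dimension S extension = extension , λ _ T T-orthoregular _ → orthoregular-size≤dimension T T-orthoregular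

mainTheorem7 : (InK : ℕ → Set) (n : ℕ) → (n ≡ 2 ⊎ n ≡ 4 ⊎ n ≡ 8) →
    Σ (System n 1) (Admissible InK) →
    HasEK InK n 1 n
mainTheorem7 InK n n∈ (S , S-admissible) =
  (S , S-admissible , E≡dimension S (extension S (proj₁ S-admissible))) ,
  λ S′ S′-admissible f E[S′]≡f →
    let (T , T-orthoregular , S′⊆T) = extension S′ (proj₁ S′-admissible)
    in  proj₂ E[S′]≡f n T T-orthoregular S′⊆T
  where
  extension : (S : System n 1) → Orthoregular S → OrthoregularExtension S n
  extension = singleton-extension n∈
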